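{- Let $d\in\mathbb{N}$ and let $\Delta$ be a pure $d$-dimensional simplicial complex on $n$ vertices with facet set $\mathcal{F}(\Delta)$. The following are equivalent: (1) $\Delta$ is unit interval. (2) There is a labelling of $V(\Delta)$ by $[n]$ such that for each facet $F=\{i_1,\dots,i_{d+1}\}$ with $i_1<\dots<i_{d+1}$ and each integer $j$ with $i_1\leq j\leq i_{d+1}$, $j\notin F$, and for every $k$ with $1\leq k\leq d+1$: $j$ and $i_k$ belong to a common facet, and $\{i_1,\dots,\widehat{i_k},\dots,i_{d+1},j\}\in\mathcal{F}(\Delta)$. (3) There is a labelling of $V(\Delta)$ by $[n]$ such that for each facet $F=\{i_1,\dots,i_{d+1}\}$ with $i_1<\dots<i_{d+1}$ and each integer $j$ with $i_1\leq j\leq i_{d+1}$, $j\notin F$: there is some $k$ with $1\leq k\leq d+1$ such that $j$ and $i_k$ belong to a common facet, and for every such $k$ we have $\{i_1,\dots,\widehat{i_k},\dots,i_{d+1},j\}\in\mathcal{F}(\Delta)$.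
   Context: A labelling of the vertex set of a simplicial complex on $n$ vertices is a bijection of the vertex set with $[n]$; vertices are identified with their labels. A pure $d$-dimensional simplicial complex $\Delta$ on $n$ vertices is called unit interval if there is a labelling of $V(\Delta)$ by $[n]$ such that for each facet $\{i_1,\dots,i_{d+1}\}$ with $i_1<\dots<i_{d+1}$, every set of integers $\{j_1,\dots,j_{d+1}\}$ with $i_1\leq j_1<\dots<j_{d+1}\leq i_{d+1}$ is a facet of $\Delta$. The notation $\widehat{i_k}$ means $i_k$ is omitted. -}

module Defs where

open import Data.Nat using (ℕ; suc)
open import Data.Fin using (Fin; _≤_)
open import Data.Fin.Subset using (Subset; _∈_; _∉_; _─_; _∪_; ⁅_⁆; ∣_∣)
open import Data.Fin.Permutation using (Permutation′; _⟨$⟩ʳ_)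
open import Data.Vec using (tabulate; lookup)
open import Data.Product using (Σ; _×_; ∃)
open import Relation.Binary.PropositionalEquality using (_≡_)

-- Pure d-dimensional: every facet has d+1 elements, there is at least one
-- facet, and every vertex lies in some facet (the vertex set is V(Δ)).
-- (Facets of equal size automatically form an antichain.)
record PureComplex (n d : ℕ) (IsFacet : Subset n → Set) : Set where
  field
    facet-size   : ∀ F → IsFacet F → ∣ F ∣ ≡ suc d
    nonempty     : ∃ λ F → IsFacet F
    vertex-cover : ∀ v → ∃ λ F → IsFacet F × v ∈ F

-- A labelling is a bijection σ : V(Δ) → [n]; σ ⟨$⟩ʳ v is the label of v.
Labelling : ℕ → Set
Labelling n = Permutation′ n

module _ {n : ℕ} (IsFacet : Subset n → Set) (σ : Labelling n) where

  preimage : Subset n → Subset n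
  preimage L = tabulate (λ v → lookup L (σ ⟨$⟩ʳ v))

  LFacet : Subset n → Set
  LFacet L = IsFacet (preimage L)

  CommonFacet : Fin n → Fin n → Set
  CommonFacet i j = ∃ λ G → LFacet G × i ∈ G × j ∈ G

Between : {n : ℕ} → Subset n → Fin n → Set
Between L j = (∃ λ a → a ∈ L × a ≤ j) × (∃ λ b → b ∈ L × j ≤ b)

exchange : {n : ℕ} → Subset n → Fin n → Fin n → Subset n
exchange L i j = (L ─ ⁅ i ⁆) ∪ ⁅ j ⁆

module _ {n : ℕ} (d : ℕ) (IsFacet : Subset n → Set) where

  UnitIntervalLabelling : Labelling n → Set
  UnitIntervalLabelling σ =
    ∀ L → LFacet IsFacet σ L →
    ∀ J → ∣ J ∣ ≡ suc d → (∀ j → j ∈ J → Between L j) → LFacet IsFacet σ J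

  UnitInterval : Set
  UnitInterval = ∃ UnitIntervalLabelling

  Cond2 : Set
  Cond2 = ∃ λ σ →
    ∀ L → LFacet IsFacet σ L → ∀ j → Between L j → j ∉ L →
    ∀ i → i ∈ L → CommonFacet IsFacet σ i j × LFacet IsFacet σ (exchange L i j)

  Cond3 : Set
  Cond3 = ∃ λ σ →
    ∀ L → LFacet IsFacet σ L → ∀ j → Between L j → j ∉ L →
    (∃ λ i → i ∈ L × CommonFacet IsFacet σ i j) ×
    (∀ i → i ∈ L → CommonFacet IsFacet σ i j → LFacet IsFacet σ (exchange L i j))

-- Trading a vertex i of a facet L for a label j between the extreme labels
-- of L never leaves the label interval of L, so (1) gives the facets of (2);
-- trading the extreme vertex of L other than i gives a facet containing both
-- i and j.  Conversely, a (d+1)-set J inside that interval is reached from L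
-- by such trades, each removing one vertex of L ─ J and adding one of J ─ L;
-- the extreme labels a = min J and b = max J stay between the current facet
-- provided a vertex i below a is traded for a, and any other i for b (or,
-- when that label is already present, for any missing one).  (3) gives (2)
-- because trading the known neighbour i₀ of j already yields a facet
-- containing j and every other i.
module Submission where

open import Defs
open import Data.Bool.Base using (Bool; true; false)
open import Data.Empty using (⊥-elim)
open import Data.Fin.Base as Fin using (Fin; toℕ)
import Data.Fin.Properties as Finₚ
open import Data.Fin.Permutation using (Permutation′; _⟨$⟩ʳ_)
open import Data.Fin.Subset
  using (Subset; outside; _∈_; _∉_; _─_; _-_; _∪_; ⁅_⁆; ∣_∣; _⊆_; _⊂_; Nonempty; Empty)
open import Data.Fin.Subset.Properties
  using (_∈?_; nonempty?; ⊆-antisym; p⊂q⇒∣p∣<∣q∣; p─⊥≡p; ∪-identityʳ; p─q⊆p; x∈p∪q⁺; x∈p∪q⁻;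
         x∈⁅x⁆; x∈⁅y⁆⇒x≡y; x∈p∧x≢y⇒x∈p-y; x∈p∧x∉q⇒x∈p─q)
open import Data.Nat.Base as ℕ using (ℕ; suc; _∸_; _<_)
open import Data.Nat.Induction using (<-wellFounded)
import Data.Nat.Properties as ℕₚ
open import Data.Product using (∃; _×_; _,_; proj₁; proj₂)
open import Data.Product.Function.Dependent.Propositional using (congˡ)
open import Data.Sum using (_⊎_; inj₁; inj₂)
open import Data.Vec.Base using (_∷_; []; tabulate; lookup; here; there)
open import Data.Vec.Properties using (lookup∘tabulate)
open import Function.Base using (_∘_)
open import Function.Bundles using (_⇔_; mk⇔)
open import Function.Properties.Equivalence using () renaming (trans to ⇔-trans)
open import Induction.WellFounded using (Acc; acc)
open import Relation.Nullary using (yes; no)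
open import Relation.Nullary.Decidable using (_×-dec_)
open import Relation.Binary.PropositionalEquality
open import Algebra.Properties.CommutativeMonoid.Sum ℕₚ.+-0-commutativeMonoid
  using (sum; sum-cong-≗; sum-permute)

private
  variable
    n : ℕ
    p q : Subset n
    x : Fin n

indicator : Bool → ℕ
indicator true  = 1
indicator false = 0

∣p∣≡∑ : (p : Subset n) → ∣ p ∣ ≡ sum (indicator ∘ lookup p)
∣p∣≡∑ []          = refl
∣p∣≡∑ (true ∷ p)  = cong suc (∣p∣≡∑ p)
∣p∣≡∑ (false ∷ p) = ∣p∣≡∑ p

∣p∘π∣≡∣p∣ : (π : Permutation′ n) (p : Subset n) → ∣ tabulate (lookup p ∘ (π ⟨$⟩ʳ_)) ∣ ≡ ∣ p ∣
∣p∘π∣≡∣p∣ π p = begin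
  ∣ tabulate (lookup p ∘ (π ⟨$⟩ʳ_)) ∣                         ≡⟨ ∣p∣≡∑ (tabulate (lookup p ∘ (π ⟨$⟩ʳ_))) ⟩
  sum (indicator ∘ lookup (tabulate (lookup p ∘ (π ⟨$⟩ʳ_)))) ≡⟨ sum-cong-≗ (cong indicator ∘ lookup∘tabulate (lookup p ∘ (π ⟨$⟩ʳ_))) ⟩
  sum (indicator ∘ lookup p ∘ (π ⟨$⟩ʳ_))                    ≡⟨ sum-permute (indicator ∘ lookup p) π ⟨
  sum (indicator ∘ lookup p)                                 ≡⟨ ∣p∣≡∑ p ⟨
  ∣ p ∣                                                      ∎
  where open ≡-Reasoning

x∈p─q⁻ : (p q : Subset n) → x ∈ p ─ q → x ∈ p × x ∉ q
x∈p─q⁻ {x = Fin.zero}  (_ ∷ p) (outside ∷ q) here      = here , λ ()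
x∈p─q⁻ {x = Fin.suc x} (_ ∷ p) (_ ∷ q)       (there m) =
  let x∈p , x∉q = x∈p─q⁻ p q m in there x∈p , λ { (there x∈q) → x∉q x∈q }

∣p-x∣+1≡∣p∣ : (p : Subset n) → x ∈ p → suc ∣ p - x ∣ ≡ ∣ p ∣
∣p-x∣+1≡∣p∣ (_ ∷ p)     here      = cong (suc ∘ ∣_∣) (p─⊥≡p p)
∣p-x∣+1≡∣p∣ (true ∷ p)  (there m) = cong suc (∣p-x∣+1≡∣p∣ p m)
∣p-x∣+1≡∣p∣ (false ∷ p) (there m) = ∣p-x∣+1≡∣p∣ p m

∣p∪⁅x⁆∣≡∣p∣+1 : (p : Subset n) → x ∉ p → ∣ p ∪ ⁅ x ⁆ ∣ ≡ suc ∣ p ∣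
∣p∪⁅x⁆∣≡∣p∣+1 {x = Fin.zero}  (true ∷ p)  x∉p = ⊥-elim (x∉p here)
∣p∪⁅x⁆∣≡∣p∣+1 {x = Fin.zero}  (false ∷ p) x∉p = cong (suc ∘ ∣_∣) (∪-identityʳ p)
∣p∪⁅x⁆∣≡∣p∣+1 {x = Fin.suc x} (true ∷ p)  x∉p = cong suc (∣p∪⁅x⁆∣≡∣p∣+1 p (x∉p ∘ there))
∣p∪⁅x⁆∣≡∣p∣+1 {x = Fin.suc x} (false ∷ p) x∉p = ∣p∪⁅x⁆∣≡∣p∣+1 p (x∉p ∘ there)

Empty─⇒⊆ : Empty (p ─ q) → p ⊆ q
Empty─⇒⊆ {p = p} {q} empty {x} x∈p with x ∈? q
... | yes x∈q = x∈q
... | no  x∉q = ⊥-elim (empty (x , x∈p∧x∉q⇒x∈p─q x∈p x∉q))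

⊆∧∣≡∣⇒≡ : p ⊆ q → ∣ p ∣ ≡ ∣ q ∣ → p ≡ q
⊆∧∣≡∣⇒≡ {p = p} {q} p⊆q ∣p∣≡∣q∣ = ⊆-antisym p⊆q (Empty─⇒⊆ q─p-empty)
  where
  q─p-empty : Empty (q ─ p)
  q─p-empty (x , x∈q─p) =
    let x∈q , x∉p = x∈p─q⁻ q p x∈q─p
    in ℕₚ.<-irrefl ∣p∣≡∣q∣ (p⊂q⇒∣p∣<∣q∣ (p⊆q , x , x∈q , x∉p))

∣≡∣⇒Nonempty─ : ∣ p ∣ ≡ ∣ q ∣ → Nonempty (p ─ q) → Nonempty (q ─ p)
∣≡∣⇒Nonempty─ {p = p} {q} ∣p∣≡∣q∣ (x , x∈p─q) with nonempty? (q ─ p)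
... | yes q─p-nonempty = q─p-nonempty
... | no  q─p-empty    = ⊥-elim (x∉q (subst (x ∈_) (sym (⊆∧∣≡∣⇒≡ (Empty─⇒⊆ q─p-empty) (sym ∣p∣≡∣q∣))) x∈p))
  where
  x∈p = proj₁ (x∈p─q⁻ p q x∈p─q)
  x∉q = proj₂ (x∈p─q⁻ p q x∈p─q)

module _ (L : Subset n) (i j : Fin n) where

  ∣exchange∣≡∣L∣ : i ∈ L → j ∉ L → ∣ exchange L i j ∣ ≡ ∣ L ∣
  ∣exchange∣≡∣L∣ i∈L j∉L =
    trans (∣p∪⁅x⁆∣≡∣p∣+1 (L - i) (j∉L ∘ p─q⊆p L ⁅ i ⁆)) (∣p-x∣+1≡∣p∣ L i∈L)

  exchange-keeps : x ∈ L → x ≢ i → x ∈ exchange L i j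
  exchange-keeps x∈L x≢i = x∈p∪q⁺ (inj₁ (x∈p∧x≢y⇒x∈p-y x∈L x≢i))

  exchange-adds : j ∈ exchange L i j
  exchange-adds = x∈p∪q⁺ (inj₂ (x∈⁅x⁆ j))

  exchange⁻ : x ∈ exchange L i j → x ∈ L ⊎ x ≡ j
  exchange⁻ {x = x} x∈L′ with x∈p∪q⁻ (L - i) ⁅ j ⁆ x∈L′
  ... | inj₁ x∈L-i = inj₁ (p─q⊆p L ⁅ i ⁆ x∈L-i)
  ... | inj₂ x∈⁅j⁆ = inj₂ (x∈⁅y⁆⇒x≡y j x∈⁅j⁆)

least-by : (key : Fin n → ℕ) (p : Subset n) → x ∈ p → Acc _<_ (key x) →
           ∃ λ m → m ∈ p × (∀ {y} → y ∈ p → key m ℕ.≤ key y)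
least-by {x = x} key p x∈p (acc rs) with Finₚ.any? (λ y → (y ∈? p) ×-dec (key y ℕₚ.<? key x))
... | yes (y , y∈p , ky<kx) = least-by key p y∈p (rs ky<kx)
... | no  none-below        = x , x∈p , λ {y} y∈p → ℕₚ.≮⇒≥ (λ ky<kx → none-below (y , y∈p , ky<kx))

minimum : (p : Subset n) → Nonempty p → ∃ λ a → a ∈ p × (∀ {y} → y ∈ p → a Fin.≤ y)
minimum p (x , x∈p) = least-by toℕ p x∈p (<-wellFounded (toℕ x))

maximum : (p : Subset n) → Nonempty p → ∃ λ b → b ∈ p × (∀ {y} → y ∈ p → y Fin.≤ b)
maximum {n} p (x , x∈p) with least-by (λ y → n ∸ toℕ y) p x∈p (<-wellFounded (n ∸ toℕ x))
... | b , b∈p , least = b , b∈p , λ {y} y∈p → ℕₚ.∸-cancelʳ-≤ (ℕₚ.<⇒≤ (Finₚ.toℕ<n y)) (least y∈p)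

J─exchange⊂J─L : (J L : Subset n) {i j : Fin n} → i ∉ J → j ∈ J ─ L → J ─ exchange L i j ⊂ J ─ L
J─exchange⊂J─L J L {i} {j} i∉J j∈J─L =
  J─L′⊆J─L , j , j∈J─L , λ j∈J─L′ → proj₂ (x∈p─q⁻ J L′ j∈J─L′) (exchange-adds L i j)
  where
  L′ = exchange L i j
  J─L′⊆J─L : J ─ L′ ⊆ J ─ L
  J─L′⊆J─L x∈J─L′ =
    let x∈J , x∉L′ = x∈p─q⁻ J L′ x∈J─L′
    in x∈p∧x∉q⇒x∈p─q x∈J (λ x∈L → x∉L′ (exchange-keeps L i j x∈L (λ { refl → i∉J x∈J })))

Spans : Subset n → Fin n → Fin n → Set
Spans L a b = (∃ λ l → l ∈ L × l Fin.≤ a) × (∃ λ u → u ∈ L × b Fin.≤ u)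

spans⇒between : {L : Subset n} {a b : Fin n} → Spans L a b → a Fin.≤ x → x Fin.≤ b → Between L x
spans⇒between ((l , l∈L , l≤a) , (u , u∈L , b≤u)) a≤x x≤b =
  (l , l∈L , Finₚ.≤-trans l≤a a≤x) , (u , u∈L , Finₚ.≤-trans x≤b b≤u)

module _ (P : Subset n → Set) where

  Adjacent : Fin n → Fin n → Set
  Adjacent i j = ∃ λ G → P G × i ∈ G × j ∈ G

  ExchangeClosed : Set
  ExchangeClosed = ∀ L → P L → ∀ j → Between L j → j ∉ L → ∀ i → i ∈ L → P (exchange L i j)

  IntervalClosed : Set
  IntervalClosed = ∀ L → P L → ∀ J → ∣ J ∣ ≡ ∣ L ∣ → (∀ j → j ∈ J → Between L j) → P J

  Cond₂ : Set
  Cond₂ = ∀ L → P L → ∀ j → Between L j → j ∉ L →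
          ∀ i → i ∈ L → Adjacent i j × P (exchange L i j)

  Cond₃ : Set
  Cond₃ = ∀ L → P L → ∀ j → Between L j → j ∉ L →
          (∃ λ i → i ∈ L × Adjacent i j) × (∀ i → i ∈ L → Adjacent i j → P (exchange L i j))

module _ {P : Subset n → Set} (closed : ExchangeClosed P)
         {J : Subset n} {a b : Fin n} (a∈J : a ∈ J) (b∈J : b ∈ J)
         (a≤J : ∀ {x} → x ∈ J → a Fin.≤ x) (J≤b : ∀ {x} → x ∈ J → x Fin.≤ b) where

  private
    exchange-towards : ∀ {L i c} → i ∉ J → Nonempty (J ─ L) → c ∈ J →
                       ∃ λ j → j ∈ J ─ L × c ∈ exchange L i j
    exchange-towards {L} {i} {c} i∉J (j₀ , j₀∈J─L) c∈J with c ∈? L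
    ... | yes c∈L = j₀ , j₀∈J─L , exchange-keeps L i j₀ c∈L (λ { refl → i∉J c∈J })
    ... | no  c∉L = c , x∈p∧x∉q⇒x∈p─q c∈J c∉L , exchange-adds L i c

    Closer : Subset n → Set
    Closer L = ∃ λ L′ → P L′ × ∣ J ∣ ≡ ∣ L′ ∣ × Spans L′ a b × ∣ J ─ L′ ∣ < ∣ J ─ L ∣

    exchange-closer : ∀ {L i j} → P L → ∣ J ∣ ≡ ∣ L ∣ → Spans L a b → i ∈ L → i ∉ J → j ∈ J ─ L →
                      Spans (exchange L i j) a b → Closer L
    exchange-closer {L} {i} {j} PL J~L spans i∈L i∉J j∈J─L spans′ =
      exchange L i j ,
      closed L PL j (spans⇒between spans (a≤J j∈J) (J≤b j∈J)) j∉L i i∈L ,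
      trans J~L (sym (∣exchange∣≡∣L∣ L i j i∈L j∉L)) ,
      spans′ ,
      p⊂q⇒∣p∣<∣q∣ (J─exchange⊂J─L J L i∉J j∈J─L)
      where
      j∈J = proj₁ (x∈p─q⁻ J L j∈J─L)
      j∉L = proj₂ (x∈p─q⁻ J L j∈J─L)

    step : ∀ {L} → P L → ∣ J ∣ ≡ ∣ L ∣ → Spans L a b → Nonempty (J ─ L) → Closer L
    step {L} PL J~L spans@((l , l∈L , l≤a) , (u , u∈L , b≤u)) J⊄L
      with i , i∈L─J ← ∣≡∣⇒Nonempty─ J~L J⊄L
      with i∈L , i∉J ← x∈p─q⁻ L J i∈L─J
      with i Finₚ.<? a
    ... | yes i<a =
      let j , j∈J─L , a∈L′ = exchange-towards i∉J J⊄L a∈J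
          i<u = ℕₚ.<-≤-trans i<a (Finₚ.≤-trans (a≤J b∈J) b≤u)
      in exchange-closer PL J~L spans i∈L i∉J j∈J─L
           ((a , a∈L′ , Finₚ.≤-refl) , (u , exchange-keeps L i j u∈L (≢-sym (Finₚ.<⇒≢ i<u)) , b≤u))
    ... | no  i≮a =
      let j , j∈J─L , b∈L′ = exchange-towards i∉J J⊄L b∈J
          a<i = Finₚ.≤∧≢⇒< (ℕₚ.≮⇒≥ i≮a) (λ { refl → i∉J a∈J })
          l<i = ℕₚ.≤-<-trans l≤a a<i
      in exchange-closer PL J~L spans i∈L i∉J j∈J─L
           ((l , exchange-keeps L i j l∈L (Finₚ.<⇒≢ l<i) , l≤a) , (b , b∈L′ , Finₚ.≤-refl))

  reach-by-exchanges : ∀ {L} → Acc _<_ ∣ J ─ L ∣ → P L → ∣ J ∣ ≡ ∣ L ∣ → Spans L a b → P J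
  reach-by-exchanges {L} (acc rs) PL J~L spans with nonempty? (J ─ L)
  ... | no  J─L-empty = subst P (sym (⊆∧∣≡∣⇒≡ (Empty─⇒⊆ J─L-empty) J~L)) PL
  ... | yes J⊄L =
    let L′ , PL′ , J~L′ , spans′ , closer = step PL J~L spans J⊄L
    in reach-by-exchanges (rs closer) PL′ J~L′ spans′

between∧∉⇒another : {L : Subset n} {j : Fin n} → Between L j → j ∉ L → ∀ i → ∃ λ k → k ∈ L × i ≢ k
between∧∉⇒another ((l , l∈L , l≤j) , (u , u∈L , j≤u)) j∉L i with i Finₚ.≟ l
... | no  i≢l  = l , l∈L , i≢l
... | yes refl = u , u∈L , λ { refl → j∉L (subst (_∈ _) (Finₚ.≤-antisym l≤j j≤u) l∈L) }

module _ {P : Subset n → Set} where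

  intervalClosed⇔exchangeClosed : IntervalClosed P ⇔ ExchangeClosed P
  intervalClosed⇔exchangeClosed = mk⇔ to from
    where
    to : IntervalClosed P → ExchangeClosed P
    to closed L PL j j-between j∉L i i∈L =
      closed L PL (exchange L i j) (∣exchange∣≡∣L∣ L i j i∈L j∉L) between
      where
      between : ∀ x → x ∈ exchange L i j → Between L x
      between x x∈L′ with exchange⁻ L i j x∈L′
      ... | inj₁ x∈L  = (x , x∈L , Finₚ.≤-refl) , (x , x∈L , Finₚ.≤-refl)
      ... | inj₂ refl = j-between

    from : ExchangeClosed P → IntervalClosed P
    from closed L PL J J~L J-between with nonempty? J
    ... | no  J-empty = subst P (sym (⊆∧∣≡∣⇒≡ (λ x∈J → ⊥-elim (J-empty (_ , x∈J))) J~L)) PL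
    ... | yes J-nonempty =
      let a , a∈J , a≤J = minimum J J-nonempty
          b , b∈J , J≤b = maximum J J-nonempty
      in reach-by-exchanges closed a∈J b∈J a≤J J≤b (<-wellFounded _) PL J~L
           (proj₁ (J-between a a∈J) , proj₂ (J-between b b∈J))

  exchangeClosed⇒adjacent : ExchangeClosed P → ∀ L → P L → ∀ j → Between L j → j ∉ L →
                            ∀ i → i ∈ L → Adjacent P i j
  exchangeClosed⇒adjacent closed L PL j j-between j∉L i i∈L =
    let k , k∈L , i≢k = between∧∉⇒another j-between j∉L i
    in exchange L k j , closed L PL j j-between j∉L k k∈L , exchange-keeps L k j i∈L i≢k , exchange-adds L k j

  exchangeClosed⇔cond₂ : ExchangeClosed P ⇔ Cond₂ P
  exchangeClosed⇔cond₂ = mk⇔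
    (λ closed L PL j j-between j∉L i i∈L →
       exchangeClosed⇒adjacent closed L PL j j-between j∉L i i∈L , closed L PL j j-between j∉L i i∈L)
    (λ cond L PL j j-between j∉L i i∈L → proj₂ (cond L PL j j-between j∉L i i∈L))

  exchangeClosed⇔cond₃ : ExchangeClosed P ⇔ Cond₃ P
  exchangeClosed⇔cond₃ = mk⇔ to from
    where
    to : ExchangeClosed P → Cond₃ P
    to closed L PL j j-between@((l , l∈L , _) , _) j∉L =
      (l , l∈L , exchangeClosed⇒adjacent closed L PL j j-between j∉L l l∈L) ,
      (λ i i∈L _ → closed L PL j j-between j∉L i i∈L)

    from : Cond₃ P → ExchangeClosed P
    from cond L PL j j-between j∉L i i∈L with cond L PL j j-between j∉L
    ... | (i₀ , i₀∈L , i₀~j) , exchange-adjacent = exchange-adjacent i i∈L i~j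
      where
      i~j : Adjacent P i j
      i~j with i Finₚ.≟ i₀
      ... | yes refl = i₀~j
      ... | no  i≢i₀ = exchange L i₀ j , exchange-adjacent i₀ i₀∈L i₀~j ,
                       exchange-keeps L i₀ j i∈L i≢i₀ , exchange-adds L i₀ j

module _ {n d : ℕ} {IsFacet : Subset n → Set} (complex : PureComplex n d IsFacet) (σ : Labelling n) where
  open PureComplex complex

  ∣labelled-facet∣≡1+d : ∀ L → LFacet IsFacet σ L → ∣ L ∣ ≡ suc d
  ∣labelled-facet∣≡1+d L PL = trans (sym (∣p∘π∣≡∣p∣ σ L)) (facet-size (preimage IsFacet σ L) PL)

  unitInterval⇔intervalClosed : UnitIntervalLabelling d IsFacet σ ⇔ IntervalClosed (LFacet IsFacet σ)
  unitInterval⇔intervalClosed = mk⇔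
    (λ ui L PL J J~L → ui L PL J (trans J~L (∣labelled-facet∣≡1+d L PL)))
    (λ closed L PL J ∣J∣≡1+d → closed L PL J (trans ∣J∣≡1+d (sym (∣labelled-facet∣≡1+d L PL))))

lemma2p5 : (n d : ℕ) (IsFacet : Subset n → Set) → PureComplex n d IsFacet →
    (UnitInterval d IsFacet ⇔ Cond2 d IsFacet) × (UnitInterval d IsFacet ⇔ Cond3 d IsFacet)
lemma2p5 n d IsFacet complex =
  congˡ (λ {σ} → ⇔-trans (unitInterval⇔exchangeClosed σ) exchangeClosed⇔cond₂) ,
  congˡ (λ {σ} → ⇔-trans (unitInterval⇔exchangeClosed σ) exchangeClosed⇔cond₃)
  where
  unitInterval⇔exchangeClosed : ∀ σ → UnitIntervalLabelling d IsFacet σ ⇔ ExchangeClosed (LFacet IsFacet σ)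
  unitInterval⇔exchangeClosed σ =
    ⇔-trans (unitInterval⇔intervalClosed complex σ) intervalClosed⇔exchangeClosed
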